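{- Let $\mathrm{S}=(P,T,F,M_0)$ be a place/transition net. If $\mathrm{S}$ is e/l-persistent, then it is e/l-$\mathrm{k}$-persistent for some $\mathrm{k}\in\mathbb{N}$, and such a $\mathrm{k}$ can be effectively computed (there is an algorithm that, given an e/l-persistent p/t-net, outputs a number $\mathrm{k}$ for which the net is e/l-$\mathrm{k}$-persistent).
   Context: A place/transition net (p/t-net) is $\mathrm{S}=(P,T,F,M_0)$ where $P$ (places) and $T$ (transitions) are finite disjoint sets, $F\subseteq P\times T\cup T\times P$ is the flow relation, and $M_0\in\mathbb{N}^P$ is the initial marking. Markings are vectors in $\mathbb{N}^P$, ordered and added componentwise. For $a\in T$, ${}^\bullet a\in\mathbb{N}^P$ is the vector with $1$ at places $p$ with $(p,a)\in F$ and $0$ elsewhere; $a^\bullet$ is the vector with $1$ at places $p$ with $(a,p)\in F$ and $0$ elsewhere. A transition $a$ is enabled in $M$ (written $Ma$) iff ${}^\bullet a\le M$; then firing $a$ yields $M'=(M-{}^\bullet a)+a^\bullet$ (written $MaM'$). This is extended to strings $w\in T^*$: $M\varepsilon M$, and $MvaM''$ iff $MvM'$ and $M'aM''$ for some $M'$; $Mw$ means $MwM'$ for some $M'$. The set $[M_0\rangle$ of reachable markings consists of all $M'$ with $M_0wM'$ for some $w\in T^*$. The net is e/l-persistent iff for all $M\in[M_0\rangle$ and all $a,b\in T$ with $a\ne b$: $Ma\wedge Mb\Rightarrow \exists v\in T^*\ Mavb$. For $\mathrm{k}\in\mathbb{N}$, a step $Ma$ is e/l-$\mathrm{k}$-persistent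 iff for every $b\in T$, $b\neq a$, $Mb$ implies that there exists $w\in T^*$ with $|w|\le\mathrm{k}$ and $Mawb$. A marking $M$ is e/l-$\mathrm{k}$-persistent iff for every $a\in T$ enabled in $M$ the step $Ma$ is e/l-$\mathrm{k}$-persistent; the net is e/l-$\mathrm{k}$-persistent iff every marking in $[M_0\rangle$ is e/l-$\mathrm{k}$-persistent. -}

module Defs where

open import Data.Nat using (ℕ; _+_; _∸_; _≤_)
open import Data.Bool using (Bool; true; false)
open import Data.Fin using (Fin)
open import Data.List using (List; []; _∷_; length)
open import Data.Product using (Σ; ∃; _×_)
open import Relation.Binary.PropositionalEquality using (_≡_)
open import Relation.Nullary using (¬_)

-- The flow relation F ⊆ P×T ∪ T×P is given by its
-- two (decidable) parts: inF p a ⇔ (p,a) ∈ F, outF a p ⇔ (a,p) ∈ F.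
record PTNet : Set where
  field
    np   : ℕ
    nt   : ℕ
    inF  : Fin np → Fin nt → Bool
    outF : Fin nt → Fin np → Bool
    M₀   : Fin np → ℕ

module _ (S : PTNet) where
  open PTNet S

  Marking : Set
  Marking = Fin np → ℕ

  Trans : Set
  Trans = Fin nt

  b2n : Bool → ℕ
  b2n true  = 1
  b2n false = 0

  pre : Trans → Marking
  pre a p = b2n (inF p a)

  post : Trans → Marking
  post a p = b2n (outF a p)

  Enabled : Marking → Trans → Set
  Enabled M a = ∀ p → pre a p ≤ M p

  Fire : Marking → Trans → Marking → Set
  Fire M a M' = Enabled M a × (∀ p → M' p ≡ (M p ∸ pre a p) + post a p)

  data Fires : Marking → List Trans → Marking → Set where
    ε-fires : ∀ {M} → Fires M [] M
    step    : ∀ {M M' M''} {a} {w} → Fire M a M' → Fires M' w M'' → Fires M (a ∷ w) M''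

  EnabledSeq : Marking → List Trans → Set
  EnabledSeq M w = ∃ λ M' → Fires M w M'

  Reachable : Marking → Set
  Reachable M = ∃ λ w → Fires M₀ w M

  ElPersistent : Set
  ElPersistent = ∀ M → Reachable M → ∀ (a b : Trans) → ¬ a ≡ b →
    Enabled M a → Enabled M b → ∃ λ v → EnabledSeq M (a ∷ v Data.List.++ (b ∷ []))

  ElKPersistentStep : ℕ → Marking → Trans → Set
  ElKPersistentStep k M a = ∀ (b : Trans) → ¬ b ≡ a → Enabled M b →
    ∃ λ w → (length w ≤ k) × EnabledSeq M (a ∷ w Data.List.++ (b ∷ []))

  ElKPersistentMarking : ℕ → Marking → Set
  ElKPersistentMarking k M = ∀ a → Enabled M a → ElKPersistentStep k M a

  ElKPersistent : ℕ → Set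
  ElKPersistent k = ∀ M → Reachable M → ElKPersistentMarking k M

-- Rackoff's bound on shortest coverings.  If b is enabled after a v, then v
-- covers the 0/1 marking •b from the marking after a, and such a covering can
-- be shortened to length at most rackoffBound |P| |P|.  The shortening is by
-- induction on the number of places that must stay nonnegative: if the run
-- keeps all these places below R = 1 + (bound for one place fewer) for
-- R ^ |P| + 1 steps, two of these intermediate markings coincide on them and
-- the loop between them is cut out; otherwise some place exceeds R, and from
-- there on it stays positive during any covering of length < R, so it can be
-- dropped from consideration.
module Submission where

open import Defs
open import Data.Nat using (ℕ)
open import Data.Product using (Σ)

open import Data.Nat using (zero; suc; _+_; _∸_; _≤_; _<_; _^_; _⊓_; z≤n; s≤s; s≤s⁻¹; _≤?_; NonZero)
open import Data.Nat.Properties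
open import Data.Nat.DivMod using (_%_; _mod_; m<n⇒m%n≡m)
open import Data.Nat.Induction using (<-wellFounded)
open import Data.Bool using (true; false)
open import Data.Fin using (Fin; toℕ; funToFin; finToFun)
open import Data.Fin.Properties using (pigeonhole; any?; toℕ-fromℕ<; toℕ<n; finToFun-funToFin)
  renaming (_≟_ to _≟ᶠ_)
open import Data.Fin.Subset using (Subset; _∈_; _-_; ⁅_⁆; ⊤; ∣_∣)
open import Data.Fin.Subset.Properties
  using (_∈?_; ∈⊤; ∣⊤∣≡n; p─q⊆p; x∈p∧x≢y⇒x∈p-y; x∈p⇒∣p-x∣<∣p∣)
open import Data.List using (List; []; _∷_; _++_; [_]; length; take; drop)
open import Data.List.Properties using (length-++; length-take; length-drop)
open import Data.Product using (∃; ∃₂; _×_; _,_; proj₁)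
open import Data.Sum using (_⊎_; inj₁; inj₂)
open import Function using (_∘_)
open import Induction.WellFounded using (Acc; acc)
open import Relation.Nullary using (yes; no; contradiction)
open import Relation.Nullary.Decidable using (_×-dec_)
open import Relation.Binary.PropositionalEquality
  using (_≡_; refl; sym; cong; cong₂; cong-app; subst; module ≡-Reasoning)

module _ {n : ℕ} where

  _≤[_]_ : (Fin n → ℕ) → Subset n → (Fin n → ℕ) → Set
  M ≤[ Q ] N = ∀ {p} → p ∈ Q → M p ≤ N p

  _≈[_]_ : (Fin n → ℕ) → Subset n → (Fin n → ℕ) → Set
  M ≈[ Q ] N = ∀ {p} → p ∈ Q → M p ≡ N p

  ≤[-]-insert : ∀ {M N Q p} → M ≤[ Q - p ] N → M p ≤ N p → M ≤[ Q ] N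
  ≤[-]-insert {p = p} M≤N M≤Np {q} q∈Q with q ≟ᶠ p
  ... | yes refl = M≤Np
  ... | no q≢p   = M≤N (x∈p∧x≢y⇒x∈p-y q∈Q q≢p)

  boundedOrLarge : ∀ {m} (Q : Subset n) (R : ℕ) (s : Fin m → Fin n → ℕ) →
                   (∀ i {p} → p ∈ Q → s i p < R) ⊎ ∃₂ λ i p → p ∈ Q × R ≤ s i p
  boundedOrLarge Q R s with any? (λ i → any? λ p → (p ∈? Q) ×-dec (R ≤? s i p))
  ... | yes (i , p , p∈Q , R≤sip) = inj₂ (i , p , p∈Q , R≤sip)
  ... | no noneLarge = inj₁ λ i {p} p∈Q → ≰⇒> λ R≤sip → noneLarge (i , p , p∈Q , R≤sip)

funToFin-injective : ∀ {m n} {f g : Fin m → Fin n} → funToFin f ≡ funToFin g → ∀ x → f x ≡ g x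
funToFin-injective {f = f} {g} eq x = begin
  f x                       ≡⟨ finToFun-funToFin f x ⟨
  finToFun (funToFin f) x   ≡⟨ cong (λ c → finToFun c x) eq ⟩
  finToFun (funToFin g) x   ≡⟨ finToFun-funToFin g x ⟩
  g x                       ∎
  where open ≡-Reasoning

mod-injective : ∀ {m o n} .{{_ : NonZero n}} → m < n → o < n → m mod n ≡ o mod n → m ≡ o
mod-injective {m} {o} {n} m<n o<n eq = begin
  m               ≡⟨ m<n⇒m%n≡m m<n ⟨
  m % n           ≡⟨ toℕ-fromℕ< _ ⟨
  toℕ (m mod n)   ≡⟨ cong toℕ eq ⟩
  toℕ (o mod n)   ≡⟨ toℕ-fromℕ< _ ⟩
  o % n           ≡⟨ m<n⇒m%n≡m o<n ⟩
  o               ∎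
  where open ≡-Reasoning

pigeonhole-bounded : ∀ {n R} .{{_ : NonZero R}} (Q : Subset n) (s : Fin (suc (R ^ n)) → Fin n → ℕ) →
                     (∀ i {p} → p ∈ Q → s i p < R) → ∃₂ λ i j → toℕ i < toℕ j × s i ≈[ Q ] s j
pigeonhole-bounded {R = R} Q s bounded
  with i , j , i<j , same ← pigeonhole (n<1+n _) (λ i → funToFin λ p → s i p mod R)
  = i , j , i<j , λ p∈Q → mod-injective (bounded i p∈Q) (bounded j p∈Q) (funToFin-injective {f = λ p → s i p mod R} {g = λ p → s j p mod R} same _)

length-take++drop< : ∀ {A : Set} {i j} (w : List A) → i < j → j ≤ length w →
                     length (take i w ++ drop j w) < length w
length-take++drop< {i = i} {j} w i<j j≤|w| = begin-strict
  length (take i w ++ drop j w)            ≡⟨ length-++ (take i w) ⟩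
  length (take i w) + length (drop j w)    ≡⟨ cong₂ _+_ (length-take i w) (length-drop j w) ⟩
  i ⊓ length w + (length w ∸ j)            ≤⟨ +-monoˡ-≤ _ (m⊓n≤m i _) ⟩
  i + (length w ∸ j)                       <⟨ +-monoˡ-< _ i<j ⟩
  j + (length w ∸ j)                       ≡⟨ m+[n∸m]≡n j≤|w| ⟩
  length w                                 ∎
  where open ≤-Reasoning

rackoffBound : ℕ → ℕ → ℕ
rackoffBound n zero    = 0
rackoffBound n (suc k) = suc (rackoffBound n k) ^ n + rackoffBound n k

module _ (S : PTNet) where
  open PTNet S using (np)

  b2n≤1 : ∀ x → b2n S x ≤ 1
  b2n≤1 true  = ≤-refl
  b2n≤1 false = z≤n

  pre≤1 : ∀ a p → pre S a p ≤ 1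
  pre≤1 a p = b2n≤1 (PTNet.inF S p a)

  fire : Marking S → Trans S → Marking S
  fire M a p = M p ∸ pre S a p + post S a p

  exec : Marking S → List (Trans S) → Marking S
  exec M []      = M
  exec M (a ∷ w) = exec (fire M a) w

  -- A firing sequence in which only the places of Q are required to carry
  -- enough tokens; elsewhere the marking is computed with truncated ∸.
  data Run (Q : Subset np) : Marking S → List (Trans S) → Set where
    []  : ∀ {M} → Run Q M []
    _∷_ : ∀ {M a w} → pre S a ≤[ Q ] M → Run Q (fire M a) w → Run Q M (a ∷ w)

  Covers : Marking S → Subset np → Marking S → List (Trans S) → Set
  Covers t Q M w = Run Q M w × t ≤[ Q ] exec M w

  exec-++ : ∀ M u v → exec M (u ++ v) ≡ exec (exec M u) v
  exec-++ M []      v = refl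
  exec-++ M (a ∷ u) v = exec-++ (fire M a) u v

  exec-take-drop : ∀ k M w → exec (exec M (take k w)) (drop k w) ≡ exec M w
  exec-take-drop zero    M w       = refl
  exec-take-drop (suc k) M []      = refl
  exec-take-drop (suc k) M (a ∷ w) = exec-take-drop k (fire M a) w

  module _ {Q : Subset np} where

    exec-cong : ∀ {M N} w → M ≈[ Q ] N → exec M w ≈[ Q ] exec N w
    exec-cong []      M≈N = M≈N
    exec-cong (a ∷ w) M≈N = exec-cong w λ p∈Q → cong (λ x → x ∸ pre S a _ + post S a _) (M≈N p∈Q)

    run-cong : ∀ {M N w} → M ≈[ Q ] N → Run Q M w → Run Q N w
    run-cong M≈N []            = []
    run-cong M≈N (_∷_ {a = a} en r) =
      (λ p∈Q → subst (pre S a _ ≤_) (M≈N p∈Q) (en p∈Q)) ∷ run-cong (exec-cong [ a ] M≈N) r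

    run-++⁺ : ∀ {M u v} → Run Q M u → Run Q (exec M u) v → Run Q M (u ++ v)
    run-++⁺ []       rv = rv
    run-++⁺ (en ∷ ru) rv = en ∷ run-++⁺ ru rv

    run-++⁻ : ∀ {M} u {v} → Run Q M (u ++ v) → Run Q M u × Run Q (exec M u) v
    run-++⁻ []      r        = [] , r
    run-++⁻ (a ∷ u) (en ∷ r) with ru , rv ← run-++⁻ u r = en ∷ ru , rv

    run-take : ∀ k {M w} → Run Q M w → Run Q M (take k w)
    run-take zero    r        = []
    run-take (suc k) []       = []
    run-take (suc k) (en ∷ r) = en ∷ run-take k r

    run-drop : ∀ k {M w} → Run Q M w → Run Q (exec M (take k w)) (drop k w)
    run-drop zero    r        = r
    run-drop (suc k) []       = []
    run-drop (suc k) (en ∷ r) = run-drop k r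

    run-mono : ∀ {Q′ M w} → (∀ {p} → p ∈ Q′ → p ∈ Q) → Run Q M w → Run Q′ M w
    run-mono Q′⊆Q []       = []
    run-mono Q′⊆Q (en ∷ r) = en ∘ Q′⊆Q ∷ run-mono Q′⊆Q r

  -- Ordinary nets: a transition removes at most one token from each place.
  ≤-fire : ∀ M a p → M p ≤ suc (fire M a p)
  ≤-fire M a p = begin
    M p                                ≤⟨ m≤n+m∸n (M p) (pre S a p) ⟩
    pre S a p + (M p ∸ pre S a p)      ≤⟨ +-monoˡ-≤ _ (pre≤1 a p) ⟩
    suc (M p ∸ pre S a p)              ≤⟨ s≤s (m≤m+n _ (post S a p)) ⟩
    suc (fire M a p)                   ∎
    where open ≤-Reasoning

  ≤-exec+length : ∀ M w p → M p ≤ exec M w p + length w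
  ≤-exec+length M []      p = ≤-reflexive (sym (+-identityʳ (M p)))
  ≤-exec+length M (a ∷ w) p = begin
    M p                                          ≤⟨ ≤-fire M a p ⟩
    suc (fire M a p)                             ≤⟨ s≤s (≤-exec+length (fire M a) w p) ⟩
    suc (exec (fire M a) w p + length w)         ≡⟨ +-suc _ (length w) ⟨
    exec (fire M a) w p + length (a ∷ w)         ∎
    where open ≤-Reasoning

  exec-positive : ∀ {M} w {p} → length w < M p → 0 < exec M w p
  exec-positive {M} w {p} |w|<Mp =
    +-cancelʳ-< (length w) 0 _ (<-≤-trans |w|<Mp (≤-exec+length M w p))

  run-insert : ∀ {Q p M w} → length w < M p → Run (Q - p) M w → Run Q M w
  run-insert                 |w|<Mp []                     = []
  run-insert {p = p} {M = M} |w|<Mp (_∷_ {a = a} {w = w} en r) =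
    ≤[-]-insert en (≤-trans (pre≤1 a p) (≤-trans (s≤s z≤n) |w|<Mp)) ∷
    run-insert (s≤s⁻¹ (≤-trans |w|<Mp (≤-fire M a p))) r

  module Coverability (t : Marking S) (t≤1 : ∀ p → t p ≤ 1) where

    ShortCover : ℕ → Subset np → Marking S → Set
    ShortCover K Q M = ∃ λ w → length w ≤ K × Covers t Q M w

    CoverableWithin : ℕ → Subset np → Set
    CoverableWithin K Q = ∀ {M w} → Covers t Q M w → ShortCover K Q M

    shortCover-mono : ∀ {K K′ Q M} → K ≤ K′ → ShortCover K Q M → ShortCover K′ Q M
    shortCover-mono K≤K′ (w , |w|≤K , cov) = w , ≤-trans |w|≤K K≤K′ , cov

    covers-insert : ∀ {Q p M w} → length w < M p → Covers t (Q - p) M w → Covers t Q M w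
    covers-insert {p = p} {w = w} |w|<Mp (r , t≤) =
      run-insert |w|<Mp r , ≤[-]-insert t≤ (≤-trans (t≤1 p) (exec-positive w |w|<Mp))

    covers-drop : ∀ k {Q M w} → Covers t Q M w → Covers t Q (exec M (take k w)) (drop k w)
    covers-drop k {Q} {M} {w} (r , t≤) =
      run-drop k r , subst (t ≤[ Q ]_) (sym (exec-take-drop k M w)) t≤

    covers-skip : ∀ {Q M} w i j → exec M (take i w) ≈[ Q ] exec M (take j w) →
                  Covers t Q M w → Covers t Q M (take i w ++ drop j w)
    covers-skip {Q} {M} w i j same (r , t≤) =
      run-++⁺ (run-take i r) (run-cong (sym ∘ same) (run-drop j r)) , λ p∈Q → subst (t _ ≤_) (same-end p∈Q) (t≤ p∈Q)
      where
      same-end : exec M w ≈[ Q ] exec M (take i w ++ drop j w)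
      same-end {p} p∈Q = begin
        exec M w p                                   ≡⟨ cong-app (exec-take-drop j M w) p ⟨
        exec (exec M (take j w)) (drop j w) p        ≡⟨ exec-cong (drop j w) (sym ∘ same) p∈Q ⟩
        exec (exec M (take i w)) (drop j w) p        ≡⟨ cong-app (exec-++ M (take i w) (drop j w)) p ⟨
        exec M (take i w ++ drop j w) p              ∎
        where open ≡-Reasoning

    shortCover-prefix : ∀ k {K Q M w} → Run Q M w → ShortCover K Q (exec M (take k w)) →
                        ShortCover (k + K) Q M
    shortCover-prefix k {K} {M = M} {w} r (w′ , |w′|≤K , r′ , t≤) =
      take k w ++ w′ , |u++w′|≤k+K , run-++⁺ (run-take k r) r′ ,
      λ p∈Q → subst (t _ ≤_) (sym (cong-app (exec-++ M (take k w) w′) _)) (t≤ p∈Q)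
      where
      |u++w′|≤k+K : length (take k w ++ w′) ≤ k + K
      |u++w′|≤k+K = begin
        length (take k w ++ w′)        ≡⟨ length-++ (take k w) ⟩
        length (take k w) + length w′  ≤⟨ +-mono-≤ (≤-trans (≤-reflexive (length-take k w)) (m⊓n≤m k _)) |w′|≤K ⟩
        k + K                          ∎
        where open ≤-Reasoning

    shortCover-large : ∀ {K Q p M w} → CoverableWithin K (Q - p) → K < M p →
                       Covers t Q M w → ShortCover K Q M
    shortCover-large {Q = Q} {p} coverable K<Mp (r , t≤)
      with w′ , |w′|≤K , cov′ ← coverable (run-mono (p─q⊆p Q ⁅ p ⁆) r , t≤ ∘ p─q⊆p Q ⁅ p ⁆)
      = w′ , |w′|≤K , covers-insert (≤-<-trans |w′|≤K K<Mp) cov′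

    coverableWithin-suc : ∀ {k Q} → (∀ {p} → p ∈ Q → CoverableWithin (rackoffBound np k) (Q - p)) →
                          CoverableWithin (rackoffBound np (suc k)) Q
    coverableWithin-suc {k} {Q} coverable-minus {w = w} = shorten w (<-wellFounded (length w))
      where
      K = rackoffBound np k
      R = suc K
      N = R ^ np
      shorten : ∀ {M} w → Acc _<_ (length w) → Covers t Q M w → ShortCover (N + K) Q M
      shorten w _ cov with length w ≤? N
      ... | yes |w|≤N = w , ≤-trans |w|≤N (m≤m+n N K) , cov
      shorten {M} w (acc shorter) cov | no |w|≰N
        with boundedOrLarge Q R (λ i → exec M (take (toℕ i) w))
      ... | inj₂ (i , p , p∈Q , large) =
        shortCover-mono (+-monoˡ-≤ K (s≤s⁻¹ (toℕ<n i)))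
          (shortCover-prefix (toℕ i) (proj₁ cov)
            (shortCover-large (coverable-minus p∈Q) large (covers-drop (toℕ i) cov)))
      ... | inj₁ bounded with i , j , i<j , same ← pigeonhole-bounded Q _ bounded =
        shorten _ (shorter (length-take++drop< w i<j j≤|w|)) (covers-skip w (toℕ i) (toℕ j) same cov)
        where
        j≤|w| : toℕ j ≤ length w
        j≤|w| = ≤-trans (s≤s⁻¹ (toℕ<n j)) (<⇒≤ (≰⇒> |w|≰N))

    coverableWithin-rackoff : ∀ k {Q} → ∣ Q ∣ ≤ k → CoverableWithin (rackoffBound np k) Q
    coverableWithin-rackoff zero    ∣Q∣≤0 cov =
      [] , z≤n , [] , λ p∈Q → contradiction (≤-trans (x∈p⇒∣p-x∣<∣p∣ p∈Q) ∣Q∣≤0) λ ()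
    coverableWithin-rackoff (suc k) ∣Q∣≤k+1 =
      coverableWithin-suc {k} λ p∈Q → coverableWithin-rackoff k (s≤s⁻¹ (≤-trans (x∈p⇒∣p-x∣<∣p∣ p∈Q) ∣Q∣≤k+1))

  enabledSeq⇒run : ∀ {M w} → EnabledSeq S M w → Run ⊤ M w
  enabledSeq⇒run (_ , fs) = fires⇒run fs
    where
    fires⇒run : ∀ {M w M′} → Fires S M w M′ → Run ⊤ M w
    fires⇒run ε-fires             = []
    fires⇒run (step (en , eq) fs) = (λ {p} _ → en p) ∷ run-cong (λ {p} _ → eq p) (fires⇒run fs)

  run⇒enabledSeq : ∀ {M w} → Run ⊤ M w → EnabledSeq S M w
  run⇒enabledSeq {M} {w} r = exec M w , run⇒fires r
    where
    run⇒fires : ∀ {M w} → Run ⊤ M w → Fires S M w (exec M w)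
    run⇒fires []       = ε-fires
    run⇒fires (en ∷ r) = step ((λ p → en ∈⊤) , λ p → refl) (run⇒fires r)

  elPersistent⇒elKPersistent : ElPersistent S → ElKPersistent S (rackoffBound np np)
  elPersistent⇒elKPersistent persistent M reachable a Ma b b≢a Mb
    with v , seq ← persistent M reachable a b (b≢a ∘ sym) Ma Mb
    with Ma′ ∷ r ← enabledSeq⇒run seq
    with rv , rb ∷ [] ← run-++⁻ v r
    with w , |w|≤ , rw , Mb′ ← Coverability.coverableWithin-rackoff (pre S b) (pre≤1 b)
                                    np (≤-reflexive (∣⊤∣≡n np)) (rv , rb)
    = w , |w|≤ , run⇒enabledSeq (Ma′ ∷ run-++⁺ rw (Mb′ ∷ []))

theorem12 : Σ (PTNet → ℕ) λ f → ∀ (S : PTNet) → ElPersistent S → ElKPersistent S (f S)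
theorem12 = (λ S → rackoffBound (PTNet.np S) (PTNet.np S)) , elPersistent⇒elKPersistent
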